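{- Let $n\in\mathbb{N}$, $i\in\{1,\dots,n-1\}$ and $u\in\mathcal{A}_n^*$. If $e_i(u)$ is defined, then $\tilde e_i(u)$ is defined and $\tilde e_i(u)=e_i(u)$. If $f_i(u)$ is defined, then $\tilde f_i(u)$ is defined and $\tilde f_i(u)=f_i(u)$.
   Context: $\mathcal{A}_n=\{1<\dots<n\}$. A word $u$ has an $i$-inversion if it contains a letter $i+1$ to the left of a letter $i$. Quasi-Kashiwara operators: if $u$ has an $i$-inversion, $e_i(u),f_i(u)$ are undefined; otherwise $e_i(u)$ replaces the leftmost letter $i+1$ of $u$ by $i$ (undefined if none), and $f_i(u)$ replaces the rightmost letter $i$ by $i+1$ (undefined if none). Kashiwara operators $\tilde e_i,\tilde f_i$ (with the convention used here): replace each letter $i$ of $u$ by $+$, each letter $i+1$ by $-$, delete all other letters (remembering which letter each sign came from), and repeatedly delete factors $-+$ until a word $+^p-^q$ remains. If $q=0$, $\tilde e_i(u)$ is undefined; otherwise $\tilde e_i(u)$ is obtained by changing the letter $i+1$ corresponding to the leftmost remaining $-$ into $i$. If $p=0$, $\tilde f_i(u)$ is undefined; otherwise $\tilde f_i(u)$ is obtained by changing the letter $i$ corresponding to the rightmost remaining $+$ into $i+1$. -}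

module Defs where

open import Data.Nat using (ℕ; zero; suc; _≤_; _<_; _≡ᵇ_)
open import Data.Bool using (Bool; true; false; if_then_else_; _∧_)
open import Data.List using (List; []; _∷_; length; reverse)
open import Data.Maybe using (Maybe; just; nothing)
open import Data.Product using (_×_; _,_; proj₁; proj₂)
open import Data.List.Relation.Unary.All using (All)

IsWord : ℕ → List ℕ → Set
IsWord n u = All (λ k → 1 ≤ k × k ≤ n) u

-- Quasi-Kashiwara operators

containsLetter : ℕ → List ℕ → Bool
containsLetter a [] = false
containsLetter a (x ∷ xs) = if x ≡ᵇ a then true else containsLetter a xs

hasInversion : ℕ → List ℕ → Bool
hasInversion i [] = false
hasInversion i (x ∷ xs) =
  if x ≡ᵇ suc i then (if containsLetter i xs then true else hasInversion i xs)
  else hasInversion i xs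

replaceLeftmost : ℕ → ℕ → List ℕ → Maybe (List ℕ)
replaceLeftmost a b [] = nothing
replaceLeftmost a b (x ∷ xs) with x ≡ᵇ a
... | true = just (b ∷ xs)
... | false with replaceLeftmost a b xs
...   | nothing = nothing
...   | just ys = just (x ∷ ys)

replaceRightmost : ℕ → ℕ → List ℕ → Maybe (List ℕ)
replaceRightmost a b [] = nothing
replaceRightmost a b (x ∷ xs) with replaceRightmost a b xs
... | just ys = just (x ∷ ys)
... | nothing = if x ≡ᵇ a then just (b ∷ xs) else nothing

qe : ℕ → List ℕ → Maybe (List ℕ)
qe i u = if hasInversion i u then nothing else replaceLeftmost (suc i) i u

qf : ℕ → List ℕ → Maybe (List ℕ)
qf i u = if hasInversion i u then nothing else replaceRightmost i (suc i) u

-- Kashiwara operators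

-- a sign: true = '+' (from a letter i), false = '-' (from a letter i+1),
-- tagged with the position in u of the letter it came from
Sign : Set
Sign = Bool × ℕ

signWordFrom : ℕ → ℕ → List ℕ → List Sign
signWordFrom i p [] = []
signWordFrom i p (x ∷ xs) =
  if x ≡ᵇ i then (true , p) ∷ signWordFrom i (suc p) xs
  else if x ≡ᵇ suc i then (false , p) ∷ signWordFrom i (suc p) xs
  else signWordFrom i (suc p) xs

signWord : ℕ → List ℕ → List Sign
signWord i u = signWordFrom i 0 u

deleteStep : List Sign → List Sign
deleteStep [] = []
deleteStep ((false , p) ∷ (true , q) ∷ s) = s
deleteStep (x ∷ s) = x ∷ deleteStep s

iterate : ℕ → List Sign → List Sign
iterate zero s = s
iterate (suc k) s = iterate k (deleteStep s)

-- repeatedly delete factors -+ ; length-many steps suffice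
reduced : List Sign → List Sign
reduced s = iterate (length s) s

leftmostMinus : List Sign → Maybe ℕ
leftmostMinus [] = nothing
leftmostMinus ((false , p) ∷ s) = just p
leftmostMinus ((true , p) ∷ s) = leftmostMinus s

rightmostPlus : List Sign → Maybe ℕ
rightmostPlus s = leftPlus (reverse s)
  where
  leftPlus : List Sign → Maybe ℕ
  leftPlus [] = nothing
  leftPlus ((true , p) ∷ s) = just p
  leftPlus ((false , p) ∷ s) = leftPlus s

setAt : ℕ → ℕ → List ℕ → List ℕ
setAt p b [] = []
setAt zero b (x ∷ xs) = b ∷ xs
setAt (suc p) b (x ∷ xs) = x ∷ setAt p b xs

ke : ℕ → List ℕ → Maybe (List ℕ)
ke i u with leftmostMinus (reduced (signWord i u))
... | nothing = nothing
... | just p = just (setAt p i u)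

kf : ℕ → List ℕ → Maybe (List ℕ)
kf i u with rightmostPlus (reduced (signWord i u))
... | nothing = nothing
... | just p = just (setAt p (suc i) u)

-- A word without i-inversion has sign word +ᵖ-ᵠ: the letters i+1 all sit to the right of the
-- letters i. Such a sign word contains no factor -+, so the cancellation leaves it unchanged, its
-- leftmost - is the leftmost letter i+1 and its rightmost + is the rightmost letter i; these are
-- exactly the letters changed by eᵢ and fᵢ.
module Submission where

open import Defs
open import Data.Nat using (ℕ; zero; suc; _+_; _≤_; _<_; _≡ᵇ_)
open import Data.Nat.Properties using (+-suc; +-identityʳ)
open import Data.Bool using (true; false)
open import Data.List using (List; []; _∷_; _++_; reverse; length)
open import Data.List.Properties using (reverse-involutive; unfold-reverse)
open import Data.Maybe using (Maybe; just; nothing; _<∣>_)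
open import Data.Product using (_×_; _,_; ∃)
open import Relation.Binary.PropositionalEquality
  using (_≡_; refl; sym; trans; cong; module ≡-Reasoning)

≡ᵇ-true⇒suc-false : ∀ x i → (x ≡ᵇ i) ≡ true → (x ≡ᵇ suc i) ≡ false
≡ᵇ-true⇒suc-false zero    zero    _ = refl
≡ᵇ-true⇒suc-false (suc x) (suc i) e = ≡ᵇ-true⇒suc-false x i e

-- A copy of the local helper of rightmostPlus, which Defs does not export.
firstPlus : List Sign → Maybe ℕ
firstPlus []               = nothing
firstPlus ((true , p) ∷ s)  = just p
firstPlus ((false , p) ∷ s) = firstPlus s

firstPlus-++ : ∀ l m → firstPlus (l ++ m) ≡ (firstPlus l <∣> firstPlus m)
firstPlus-++ []                m = refl
firstPlus-++ ((true , p) ∷ l)  m = refl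
firstPlus-++ ((false , p) ∷ l) m = firstPlus-++ l m

rightmostPlus-reverse : ∀ t → rightmostPlus (reverse t) ≡ firstPlus t
rightmostPlus-reverse [] = refl
rightmostPlus-reverse ((true , p) ∷ t) rewrite reverse-involutive ((true , p) ∷ t) = refl
rightmostPlus-reverse ((false , p) ∷ t)
  rewrite reverse-involutive ((false , p) ∷ t)
        | sym (rightmostPlus-reverse t)
        | reverse-involutive t = refl

rightmostPlus≡firstPlus∘reverse : ∀ s → rightmostPlus s ≡ firstPlus (reverse s)
rightmostPlus≡firstPlus∘reverse s =
  trans (cong rightmostPlus (sym (reverse-involutive s))) (rightmostPlus-reverse (reverse s))

rightmostPlus-∷ : ∀ σ s → rightmostPlus (σ ∷ s) ≡ (rightmostPlus s <∣> firstPlus (σ ∷ []))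
rightmostPlus-∷ σ s = begin
  rightmostPlus (σ ∷ s)                         ≡⟨ rightmostPlus≡firstPlus∘reverse (σ ∷ s) ⟩
  firstPlus (reverse (σ ∷ s))                   ≡⟨ cong firstPlus (unfold-reverse σ s) ⟩
  firstPlus (reverse s ++ σ ∷ [])               ≡⟨ firstPlus-++ (reverse s) (σ ∷ []) ⟩
  firstPlus (reverse s) <∣> firstPlus (σ ∷ [])  ≡⟨ cong (_<∣> firstPlus (σ ∷ [])) (sym (rightmostPlus≡firstPlus∘reverse s)) ⟩
  rightmostPlus s <∣> firstPlus (σ ∷ [])        ∎
  where open ≡-Reasoning

rightmostPlus-signWordFrom-∷ : ∀ i p x xs {q} → rightmostPlus (signWordFrom i (suc p) xs) ≡ just q →
  rightmostPlus (signWordFrom i p (x ∷ xs)) ≡ just q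
rightmostPlus-signWordFrom-∷ i p x xs eq with x ≡ᵇ i
... | true rewrite rightmostPlus-∷ (true , p) (signWordFrom i (suc p) xs) | eq = refl
... | false with x ≡ᵇ suc i
...   | true rewrite rightmostPlus-∷ (false , p) (signWordFrom i (suc p) xs) | eq = refl
...   | false = eq

leftmostMinus-signWordFrom : ∀ i p u v → replaceLeftmost (suc i) i u ≡ just v →
  ∃ λ k → leftmostMinus (signWordFrom i p u) ≡ just (p + k) × setAt k i u ≡ v
leftmostMinus-signWordFrom i p (x ∷ xs) v h with x ≡ᵇ suc i in isSuc
leftmostMinus-signWordFrom i p (x ∷ xs) v refl | true with x ≡ᵇ i in isI
... | true with () ← trans (sym isSuc) (≡ᵇ-true⇒suc-false x i isI)
... | false = 0 , cong just (sym (+-identityʳ p)) , refl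
leftmostMinus-signWordFrom i p (x ∷ xs) v h | false with replaceLeftmost (suc i) i xs in rest
leftmostMinus-signWordFrom i p (x ∷ xs) v refl | false | just ys
  with leftmostMinus-signWordFrom i (suc p) xs ys rest
... | k , eq , refl with x ≡ᵇ i
...   | true  = suc k , trans eq (cong just (sym (+-suc p k))) , refl
...   | false = suc k , trans eq (cong just (sym (+-suc p k))) , refl

rightmostPlus-signWordFrom-nothing : ∀ i p u b → replaceRightmost i b u ≡ nothing →
  rightmostPlus (signWordFrom i p u) ≡ nothing
rightmostPlus-signWordFrom-nothing i p [] b h = refl
rightmostPlus-signWordFrom-nothing i p (x ∷ xs) b h with replaceRightmost i b xs in rest
rightmostPlus-signWordFrom-nothing i p (x ∷ xs) b h | nothing with x ≡ᵇ i
... | false with x ≡ᵇ suc i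
...   | true
  rewrite rightmostPlus-∷ (false , p) (signWordFrom i (suc p) xs)
        | rightmostPlus-signWordFrom-nothing i (suc p) xs b rest = refl
...   | false = rightmostPlus-signWordFrom-nothing i (suc p) xs b rest

rightmostPlus-signWordFrom : ∀ i p u v → replaceRightmost i (suc i) u ≡ just v →
  ∃ λ k → rightmostPlus (signWordFrom i p u) ≡ just (p + k) × setAt k (suc i) u ≡ v
rightmostPlus-signWordFrom i p (x ∷ xs) v h with replaceRightmost i (suc i) xs in rest
rightmostPlus-signWordFrom i p (x ∷ xs) v refl | just ys
  with rightmostPlus-signWordFrom i (suc p) xs ys rest
... | k , eq , refl =
  suc k , trans (rightmostPlus-signWordFrom-∷ i p x xs eq) (cong just (sym (+-suc p k))) , refl
rightmostPlus-signWordFrom i p (x ∷ xs) v h | nothing with x ≡ᵇ i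
rightmostPlus-signWordFrom i p (x ∷ xs) v refl | nothing | true
  rewrite rightmostPlus-∷ (true , p) (signWordFrom i (suc p) xs)
        | rightmostPlus-signWordFrom-nothing i (suc p) xs (suc i) rest
  = 0 , cong just (sym (+-identityʳ p)) , refl

data Minuses : List Sign → Set where
  []   : Minuses []
  -∷_ : ∀ {p s} → Minuses s → Minuses ((false , p) ∷ s)

data PlusesMinuses : List Sign → Set where
  minuses : ∀ {s} → Minuses s → PlusesMinuses s
  +∷_    : ∀ {p s} → PlusesMinuses s → PlusesMinuses ((true , p) ∷ s)

deleteStep-minuses : ∀ {s} → Minuses s → deleteStep s ≡ s
deleteStep-minuses []           = refl
deleteStep-minuses (-∷ [])      = refl
deleteStep-minuses (-∷ (-∷ ms)) = cong (_ ∷_) (deleteStep-minuses (-∷ ms))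

deleteStep-plusesMinuses : ∀ {s} → PlusesMinuses s → deleteStep s ≡ s
deleteStep-plusesMinuses (minuses ms) = deleteStep-minuses ms
deleteStep-plusesMinuses (+∷ pms)     = cong (_ ∷_) (deleteStep-plusesMinuses pms)

iterate-fixpoint : ∀ k s → deleteStep s ≡ s → iterate k s ≡ s
iterate-fixpoint zero    s fixed = refl
iterate-fixpoint (suc k) s fixed rewrite fixed = iterate-fixpoint k s fixed

reduced-plusesMinuses : ∀ {s} → PlusesMinuses s → reduced s ≡ s
reduced-plusesMinuses {s} pms = iterate-fixpoint (length s) s (deleteStep-plusesMinuses pms)

signWordFrom-minuses : ∀ i p u → containsLetter i u ≡ false → Minuses (signWordFrom i p u)
signWordFrom-minuses i p [] h = []
signWordFrom-minuses i p (x ∷ xs) h with x ≡ᵇ i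
... | false with x ≡ᵇ suc i
...   | true  = -∷ signWordFrom-minuses i (suc p) xs h
...   | false = signWordFrom-minuses i (suc p) xs h

signWordFrom-plusesMinuses : ∀ i p u → hasInversion i u ≡ false → PlusesMinuses (signWordFrom i p u)
signWordFrom-plusesMinuses i p [] h = minuses []
signWordFrom-plusesMinuses i p (x ∷ xs) h with x ≡ᵇ suc i in isSuc
... | true with containsLetter i xs in noI
...   | false with x ≡ᵇ i in isI
...     | true with () ← trans (sym isSuc) (≡ᵇ-true⇒suc-false x i isI)
...     | false = minuses (-∷ signWordFrom-minuses i (suc p) xs noI)
signWordFrom-plusesMinuses i p (x ∷ xs) h | false with x ≡ᵇ i
... | true  = +∷ signWordFrom-plusesMinuses i (suc p) xs h
... | false = signWordFrom-plusesMinuses i (suc p) xs h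

ke-just : ∀ i u {p} → leftmostMinus (reduced (signWord i u)) ≡ just p → ke i u ≡ just (setAt p i u)
ke-just i u eq rewrite eq = refl

kf-just : ∀ i u {p} → rightmostPlus (reduced (signWord i u)) ≡ just p → kf i u ≡ just (setAt p (suc i) u)
kf-just i u eq rewrite eq = refl

qe⇒ke : ∀ i u v → qe i u ≡ just v → ke i u ≡ just v
qe⇒ke i u v h with hasInversion i u in noInversion
... | false with leftmostMinus-signWordFrom i 0 u v h
...   | k , eq , refl = ke-just i u (begin
  leftmostMinus (reduced (signWord i u))  ≡⟨ cong leftmostMinus (reduced-plusesMinuses (signWordFrom-plusesMinuses i 0 u noInversion)) ⟩
  leftmostMinus (signWord i u)            ≡⟨ eq ⟩
  just k                                  ∎)
  where open ≡-Reasoning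

qf⇒kf : ∀ i u v → qf i u ≡ just v → kf i u ≡ just v
qf⇒kf i u v h with hasInversion i u in noInversion
... | false with rightmostPlus-signWordFrom i 0 u v h
...   | k , eq , refl = kf-just i u (begin
  rightmostPlus (reduced (signWord i u))  ≡⟨ cong rightmostPlus (reduced-plusesMinuses (signWordFrom-plusesMinuses i 0 u noInversion)) ⟩
  rightmostPlus (signWord i u)            ≡⟨ eq ⟩
  just k                                  ∎)
  where open ≡-Reasoning

proposition5p2 : (n i : ℕ) → 1 ≤ i → i < n → (u : List ℕ) → IsWord n u →
    (∀ v → qe i u ≡ just v → ke i u ≡ just v) × (∀ v → qf i u ≡ just v → kf i u ≡ just v)
proposition5p2 n i _ _ u _ = qe⇒ke i u , qf⇒kf i u
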